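{- Let $G_1, G_2$ be finite groups, $A$ a finite abelian group, and $r_1 : G_1 \to A$, $r_2 : G_2 \to A$ surjective homomorphisms. Let $\mathcal{G} = \{(g_1,g_2) \in G_1 \times G_2 : r_1(g_1) = r_2(g_2)\}$, and let $Z(\cdot)$ denote the center. Then: (i) if $r_2|_{Z(G_2)}$ is trivial, then $Z(\mathcal{G}) = \ker(r_1|_{Z(G_1)}) \times Z(G_2)$; (ii) $Z(\mathcal{G}) = Z(G_1) \times Z(G_2)$ if and only if $r_1|_{Z(G_1)}$ and $r_2|_{Z(G_2)}$ are both trivial. -}

module Defs where

open import Level using (Level; _⊔_)
open import Data.Nat using (ℕ)
open import Data.Fin using (Fin)
open import Data.Product using (Σ; _×_; _,_; proj₁; proj₂)
open import Algebra.Bundles using (Group; AbelianGroup)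
open import Algebra.Morphism.Structures using (IsGroupHomomorphism)
open import Function.Bundles using (Inverse)
open import Function.Definitions using (Surjective)
import Relation.Binary.PropositionalEquality as ≡
import Algebra.Construct.DirectProduct as DP

private variable a b c ℓ₁ ℓ₂ ℓ₃ : Level

Finite : Group a ℓ₁ → Set (a ⊔ ℓ₁)
Finite G = Σ ℕ λ n → Inverse (≡.setoid (Fin n)) (Group.setoid G)

IsHom : (G : Group a ℓ₁) (H : Group b ℓ₂) → (Group.Carrier G → Group.Carrier H) → Set (a ⊔ ℓ₁ ⊔ ℓ₂)
IsHom G H f = IsGroupHomomorphism (Group.rawGroup G) (Group.rawGroup H) f

IsSurj : (G : Group a ℓ₁) (H : Group b ℓ₂) → (Group.Carrier G → Group.Carrier H) → Set (a ⊔ b ⊔ ℓ₁ ⊔ ℓ₂)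
IsSurj G H f = Surjective (Group._≈_ G) (Group._≈_ H) f

InCenter : (G : Group a ℓ₁) → Group.Carrier G → Set (a ⊔ ℓ₁)
InCenter G g = ∀ h → g ∙ h ≈ h ∙ g
  where open Group G

InCenterOfSub : (G : Group a ℓ₁) → (Group.Carrier G → Set c) → Group.Carrier G → Set (a ⊔ ℓ₁ ⊔ c)
InCenterOfSub G H x = H x × (∀ y → H y → x ∙ y ≈ y ∙ x)
  where open Group G

_×ᴳ_ : Group a ℓ₁ → Group b ℓ₂ → Group (a ⊔ b) (ℓ₁ ⊔ ℓ₂)
G₁ ×ᴳ G₂ = DP.group G₁ G₂

InFibre : (G₁ : Group a ℓ₁) (G₂ : Group b ℓ₂) (A : AbelianGroup c ℓ₃)
        → (Group.Carrier G₁ → AbelianGroup.Carrier A)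
        → (Group.Carrier G₂ → AbelianGroup.Carrier A)
        → Group.Carrier (G₁ ×ᴳ G₂) → Set ℓ₃
InFibre G₁ G₂ A r₁ r₂ (g₁ , g₂) = AbelianGroup._≈_ A (r₁ g₁) (r₂ g₂)

TrivialOnCenter : (G : Group a ℓ₁) (A : AbelianGroup c ℓ₃)
                → (Group.Carrier G → AbelianGroup.Carrier A) → Set (a ⊔ ℓ₁ ⊔ ℓ₃)
TrivialOnCenter G A r = ∀ z → InCenter G z → AbelianGroup._≈_ A (r z) (AbelianGroup.ε A)

{-# OPTIONS --safe #-}
module Submission where

open import Defs
open import Level using (Level)
open import Data.Product using (_×_; _,_; proj₁; proj₂)
open import Algebra.Bundles using (Group; AbelianGroup)
open import Function.Bundles using (_⇔_; mk⇔; module Equivalence)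
open import Algebra.Morphism.Structures using (module IsGroupHomomorphism)

-- Surjectivity of r₂ lets every h ∈ G₁ be completed to some (h , k) ∈ 𝒢, so an
-- element of Z(𝒢) commutes with all of G₁ in its first coordinate; symmetrically
-- for the second.  Hence Z(𝒢) = {(z₁ , z₂) ∈ Z(G₁) × Z(G₂) : r₁ z₁ = r₂ z₂},
-- and both parts are read off this description by testing pairs (z , ε) and
-- (ε , z).

private variable a b c ℓ₁ ℓ₂ ℓ₃ : Level

ε-central : (G : Group a ℓ₁) → InCenter G (Group.ε G)
ε-central G h = trans (identityˡ h) (sym (identityʳ h))
  where open Group G

module FibreProduct
  (G₁ : Group a ℓ₁) (G₂ : Group b ℓ₂) (A : AbelianGroup c ℓ₃)
  (r₁ : Group.Carrier G₁ → AbelianGroup.Carrier A)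
  (r₂ : Group.Carrier G₂ → AbelianGroup.Carrier A)
  where

  private
    module G₁ = Group G₁
    module G₂ = Group G₂
    module A = AbelianGroup A
    open Equivalence using (to; from)

  InCenterOfFibre : G₁.Carrier → G₂.Carrier → Set _
  InCenterOfFibre g₁ g₂ = InCenterOfSub (G₁ ×ᴳ G₂) (InFibre G₁ G₂ A r₁ r₂) (g₁ , g₂)

  proj₁-central : IsSurj G₂ A.group r₂ →
                  ∀ {g₁ g₂} → InCenterOfFibre g₁ g₂ → InCenter G₁ g₁
  proj₁-central surj₂ (_ , commutes) h =
    let (k , r₂k≈r₁h) = surj₂ (r₁ h)
    in proj₁ (commutes (h , k) (A.sym (r₂k≈r₁h G₂.refl)))

  proj₂-central : IsSurj G₁ A.group r₁ →
                  ∀ {g₁ g₂} → InCenterOfFibre g₁ g₂ → InCenter G₂ g₂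
  proj₂-central surj₁ (_ , commutes) h =
    let (k , r₁k≈r₂h) = surj₁ (r₂ h)
    in proj₂ (commutes (k , h) (r₁k≈r₂h G₁.refl))

  central-pair-inCenterOfFibre : ∀ {g₁ g₂} → InCenter G₁ g₁ → InCenter G₂ g₂ →
                                 r₁ g₁ A.≈ r₂ g₂ → InCenterOfFibre g₁ g₂
  central-pair-inCenterOfFibre z₁ z₂ r₁g₁≈r₂g₂ =
    r₁g₁≈r₂g₂ , λ (h₁ , h₂) _ → z₁ h₁ , z₂ h₂

  inCenterOfFibre⇔ : IsSurj G₁ A.group r₁ → IsSurj G₂ A.group r₂ → ∀ g₁ g₂ →
                     InCenterOfFibre g₁ g₂ ⇔
                     (InCenter G₁ g₁ × InCenter G₂ g₂ × r₁ g₁ A.≈ r₂ g₂)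
  inCenterOfFibre⇔ surj₁ surj₂ g₁ g₂ = mk⇔
    (λ z → proj₁-central surj₂ z , proj₂-central surj₁ z , proj₁ z)
    (λ (z₁ , z₂ , r₁g₁≈r₂g₂) → central-pair-inCenterOfFibre z₁ z₂ r₁g₁≈r₂g₂)

  inCenterOfFibre⇔-if-trivialOnCenter₂ :
    IsSurj G₁ A.group r₁ → IsSurj G₂ A.group r₂ → TrivialOnCenter G₂ A r₂ →
    ∀ g₁ g₂ → InCenterOfFibre g₁ g₂ ⇔ ((InCenter G₁ g₁ × r₁ g₁ A.≈ A.ε) × InCenter G₂ g₂)
  inCenterOfFibre⇔-if-trivialOnCenter₂ surj₁ surj₂ triv₂ g₁ g₂ = mk⇔
    (λ z → let (z₁ , z₂ , r₁g₁≈r₂g₂) = to (inCenterOfFibre⇔ surj₁ surj₂ g₁ g₂) z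
           in (z₁ , A.trans r₁g₁≈r₂g₂ (triv₂ g₂ z₂)) , z₂)
    (λ ((z₁ , r₁g₁≈ε) , z₂) →
      central-pair-inCenterOfFibre z₁ z₂ (A.trans r₁g₁≈ε (A.sym (triv₂ g₂ z₂))))

  CenterOfFibreIsProduct : Set _
  CenterOfFibreIsProduct = ∀ g₁ g₂ → InCenterOfFibre g₁ g₂ ⇔ (InCenter G₁ g₁ × InCenter G₂ g₂)

  trivialOnCenters-if-centerOfFibreIsProduct :
    IsHom G₁ A.group r₁ → IsHom G₂ A.group r₂ → CenterOfFibreIsProduct →
    TrivialOnCenter G₁ A r₁ × TrivialOnCenter G₂ A r₂
  trivialOnCenters-if-centerOfFibreIsProduct hom₁ hom₂ Z𝒢⇔Z₁×Z₂ =
      (λ z z∈Z₁ → A.trans (r₁≈r₂-on-centers z∈Z₁ (ε-central G₂)) (IsGroupHomomorphism.ε-homo hom₂))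
    , (λ z z∈Z₂ → A.trans (A.sym (r₁≈r₂-on-centers (ε-central G₁) z∈Z₂)) (IsGroupHomomorphism.ε-homo hom₁))
    where
    r₁≈r₂-on-centers : ∀ {z₁ z₂} → InCenter G₁ z₁ → InCenter G₂ z₂ → r₁ z₁ A.≈ r₂ z₂
    r₁≈r₂-on-centers {z₁} {z₂} z₁∈Z₁ z₂∈Z₂ = proj₁ (from (Z𝒢⇔Z₁×Z₂ z₁ z₂) (z₁∈Z₁ , z₂∈Z₂))

  centerOfFibreIsProduct-if-trivialOnCenters :
    IsSurj G₁ A.group r₁ → IsSurj G₂ A.group r₂ →
    TrivialOnCenter G₁ A r₁ × TrivialOnCenter G₂ A r₂ → CenterOfFibreIsProduct
  centerOfFibreIsProduct-if-trivialOnCenters surj₁ surj₂ (triv₁ , triv₂) g₁ g₂ = mk⇔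
    (λ z → proj₁-central surj₂ z , proj₂-central surj₁ z)
    (λ (z₁ , z₂) → central-pair-inCenterOfFibre z₁ z₂ (A.trans (triv₁ g₁ z₁) (A.sym (triv₂ g₂ z₂))))

lemma2p2 : ∀ {a b c ℓ₁ ℓ₂ ℓ₃ : Level}
    (G₁ : Group a ℓ₁) (G₂ : Group b ℓ₂) (A : AbelianGroup c ℓ₃)
    → Finite G₁ → Finite G₂ → Finite (AbelianGroup.group A)
    → (r₁ : Group.Carrier G₁ → AbelianGroup.Carrier A)
    → (r₂ : Group.Carrier G₂ → AbelianGroup.Carrier A)
    → IsHom G₁ (AbelianGroup.group A) r₁ → IsSurj G₁ (AbelianGroup.group A) r₁
    → IsHom G₂ (AbelianGroup.group A) r₂ → IsSurj G₂ (AbelianGroup.group A) r₂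
    → (TrivialOnCenter G₂ A r₂
        → ∀ g₁ g₂ → (InCenterOfSub (G₁ ×ᴳ G₂) (InFibre G₁ G₂ A r₁ r₂) (g₁ , g₂)
                      ⇔ ((InCenter G₁ g₁ × AbelianGroup._≈_ A (r₁ g₁) (AbelianGroup.ε A)) × InCenter G₂ g₂)))
      × ((∀ g₁ g₂ → (InCenterOfSub (G₁ ×ᴳ G₂) (InFibre G₁ G₂ A r₁ r₂) (g₁ , g₂)
                      ⇔ (InCenter G₁ g₁ × InCenter G₂ g₂)))
         ⇔ (TrivialOnCenter G₁ A r₁ × TrivialOnCenter G₂ A r₂))
lemma2p2 G₁ G₂ A _ _ _ r₁ r₂ hom₁ surj₁ hom₂ surj₂ =
    inCenterOfFibre⇔-if-trivialOnCenter₂ surj₁ surj₂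
  , mk⇔ (trivialOnCenters-if-centerOfFibreIsProduct hom₁ hom₂)
        (centerOfFibreIsProduct-if-trivialOnCenters surj₁ surj₂)
  where open FibreProduct G₁ G₂ A r₁ r₂
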